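{- Let $G$ be a finite simple graph that is $3K_1$-free (i.e., $G$ contains no three pairwise non-adjacent vertices). If $\Delta(G) \geq 9$, then $\chi(G) \leq \max\{\omega(G), \Delta(G) - 1\}$. (That is, the Borodin–Kostochka conjecture holds for $3K_1$-free graphs.)
   Context: $\omega(G)$ denotes the clique number of $G$ (the size of a maximum clique), $\Delta(G)$ the maximum degree, and $\chi(G)$ the chromatic number. The Borodin–Kostochka conjecture asserts that every graph with $\Delta(G)\ge 9$ satisfies $\chi(G)\le\max\{\omega(G),\Delta(G)-1\}$. -}

module Defs where

open import Data.Nat using (ℕ; _≤_; _⊔_; _∸_)
open import Data.Fin using (Fin)
open import Data.Bool using (Bool; true; false)
open import Data.List using (List; length; filterᵇ; allFin)
open import Data.List.Relation.Unary.Unique.Propositional using (Unique)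
open import Data.List.Relation.Unary.All using (All)
open import Data.List.Membership.Propositional using (_∈_)
open import Data.Sum using (_⊎_)
open import Data.Product using (Σ; _×_; ∃)
open import Relation.Binary.PropositionalEquality using (_≡_; _≢_)

record Graph : Set where
  field
    n      : ℕ
    adj    : Fin n → Fin n → Bool
    sym    : ∀ u v → adj u v ≡ adj v u
    irrefl : ∀ v → adj v v ≡ false

module _ (G : Graph) where
  open Graph G

  Adj : Fin n → Fin n → Set
  Adj u v = adj u v ≡ true

  degree : Fin n → ℕ
  degree v = length (filterᵇ (adj v) (allFin n))

  -- d is the maximum degree Δ(G): an upper bound attained by some vertex
  -- (for the empty graph no vertex exists; the theorem's hypothesis Δ ≥ 9
  -- forces n ≥ 1 anyway).
  IsMaxDegree : ℕ → Set
  IsMaxDegree d = (∀ v → degree v ≤ d) × (∃ λ v → degree v ≡ d)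

  IsClique : List (Fin n) → Set
  IsClique vs = Unique vs × (∀ u v → u ∈ vs → v ∈ vs → u ≢ v → Adj u v)

  ThreeK1Free : Set
  ThreeK1Free = ∀ u v w → u ≢ v → v ≢ w → u ≢ w →
                Adj u v ⊎ (Adj v w ⊎ Adj u w)

  IsCliqueNumber : ℕ → Set
  IsCliqueNumber ω = (∃ λ vs → IsClique vs × length vs ≡ ω)
                   × (∀ vs → IsClique vs → length vs ≤ ω)

  ProperColouring : (k : ℕ) → (Fin n → Fin k) → Set
  ProperColouring k c = ∀ u v → Adj u v → c u ≢ c v

  Colourable : ℕ → Set
  Colourable k = Σ (Fin n → Fin k) (ProperColouring k)

module Submission where

-- An independent set of a 3K₁-free graph has at most two vertices, so colourings of G correspond to
-- matchings M of the complement Ḡ: a colour class is a matched pair or a single unmatched vertex, and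
-- M needs #pairs + #unmatched = n − |M| colours. With k = max{ω, Δ − 1}, the graph Ḡ is triangle-free,
-- its independent sets (the cliques of G) have at most k vertices, and its minimum degree is at least
-- n − k − 2. Counting Ḡ-neighbourhoods with k ≥ 8 gives n ≤ 2k. As long as M needs more than k colours
-- it leaves two vertices unmatched, and either there is an augmenting path of length 1 or 3, or the
-- set of unmatched vertices together with one well-chosen end of every matched pair has more than k
-- vertices, hence contains a Ḡ-edge, from which an augmenting path of length 5 or 7 is built.
-- Augmenting until at most k colours are needed proves the theorem.

open import Defs
open import Data.Nat using (ℕ; zero; suc; _+_; _*_; _∸_; _⊔_; _≤_; _<_; z≤n; s≤s; _<ᵇ_; _≤?_)
open import Data.Nat.Properties hiding (_≟_)
open import Data.Nat.Tactic.RingSolver using (solve; solve-∀)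
open import Data.Fin using (Fin; toℕ; fromℕ<)
open import Data.Fin.Properties using (_≟_; toℕ-injective; toℕ-fromℕ<; any?)
open import Data.Bool using (Bool; true; false; not; _∧_; _∨_; if_then_else_; T; T?)
import Data.Bool as Bool
open import Data.Bool.Properties using (∧-conicalˡ; ∧-conicalʳ; ∨-zeroʳ; ∧-zeroʳ; ¬-not; not-¬)
open import Data.Unit using (tt)
open import Data.List using (List; []; _∷_; length; filterᵇ; _++_; allFin)
open import Data.List.Properties using (length-tabulate)
open import Data.List.Membership.Propositional using (_∈_)
open import Data.List.Membership.Propositional.Properties using (∈-∃++; ∈-++⁻; ∈-++⁺ˡ; ∈-++⁺ʳ; ∈-allFin; ∈-filter⁻)
open import Data.List.Relation.Unary.Any using (here; there)
open import Data.List.Relation.Unary.All as All using (All)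
import Data.List.Relation.Unary.AllPairs as AllPairs
open import Data.List.Relation.Unary.Unique.Propositional using (Unique)
open import Data.List.Relation.Unary.Unique.Propositional.Properties using (allFin⁺; filter⁺)
open import Data.Product using (Σ; _×_; _,_; ∃; proj₁; proj₂; uncurry)
open import Data.Sum using (_⊎_; inj₁; inj₂; [_,_]′)
open import Data.Empty using (⊥; ⊥-elim)
open import Function using (_∘_)
open import Relation.Nullary using (¬_; ¬?; Dec; yes; no; does; contradiction)
open import Relation.Nullary.Decidable using (dec-true; dec-false; _×-dec_)
open import Relation.Binary.Definitions using (tri<; tri≈; tri>)
open import Relation.Binary.PropositionalEquality

true≢false : true ≢ false
true≢false ()

∉⇒≢ : ∀ {a} {A : Set a} {x y : A} {xs : List A} → All (x ≢_) xs → y ∈ xs → x ≢ y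
∉⇒≢ (x≢y All.∷ _) (here refl) = x≢y
∉⇒≢ (_ All.∷ x∉) (there y∈) = ∉⇒≢ x∉ y∈

∧-true : ∀ {a b} → (a ∧ b) ≡ true → a ≡ true × b ≡ true
∧-true {a} {b} e = ∧-conicalˡ a b e , ∧-conicalʳ a b e

∨-introˡ : ∀ {a} b → a ≡ true → (a ∨ b) ≡ true
∨-introˡ b refl = refl

∨-introʳ : ∀ a {b} → b ≡ true → (a ∨ b) ≡ true
∨-introʳ a refl = ∨-zeroʳ a

∨-elim : ∀ {a b} → (a ∨ b) ≡ true → a ≡ true ⊎ b ≡ true
∨-elim {true} _ = inj₁ refl
∨-elim {false} e = inj₂ e

not-true : ∀ {a} → not a ≡ true → a ≡ false
not-true {false} _ = refl

<ᵇ-true : ∀ {a b} → a < b → (a <ᵇ b) ≡ true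
<ᵇ-true {a} {b} a<b with a <ᵇ b | <⇒<ᵇ a<b
... | true | _ = refl

<ᵇ-false : ∀ {a b} → ¬ a < b → (a <ᵇ b) ≡ false
<ᵇ-false {a} {b} a≮b with a <ᵇ b in e
... | false = refl
... | true = contradiction (<ᵇ⇒< a b (subst T (sym e) tt)) a≮b

<ᵇ⇒<′ : ∀ {a b} → (a <ᵇ b) ≡ true → a < b
<ᵇ⇒<′ {a} {b} e = <ᵇ⇒< a b (subst T (sym e) tt)

module Counting {a} {A : Set a} where

  count : (A → Bool) → List A → ℕ
  count p [] = 0
  count p (x ∷ xs) = if p x then suc (count p xs) else count p xs

  length-filterᵇ : ∀ p xs → length (filterᵇ p xs) ≡ count p xs
  length-filterᵇ p [] = refl
  length-filterᵇ p (x ∷ xs) with p x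
  ... | true = cong suc (length-filterᵇ p xs)
  ... | false = length-filterᵇ p xs

  count-mono : ∀ p q xs → (∀ x → p x ≡ true → q x ≡ true) → count p xs ≤ count q xs
  count-mono p q [] p⇒q = z≤n
  count-mono p q (x ∷ xs) p⇒q with p x in px | q x in qx
  ... | true | true = s≤s (count-mono p q xs p⇒q)
  ... | true | false = contradiction (trans (sym (p⇒q x px)) qx) true≢false
  ... | false | true = m≤n⇒m≤1+n (count-mono p q xs p⇒q)
  ... | false | false = count-mono p q xs p⇒q

  count-mono-< : ∀ p q xs → (∀ x → p x ≡ true → q x ≡ true) →
                 ∀ y → y ∈ xs → q y ≡ true → p y ≡ false → count p xs < count q xs
  count-mono-< p q (x ∷ xs) p⇒q y (here refl) qy py rewrite qy | py = s≤s (count-mono p q xs p⇒q)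
  count-mono-< p q (x ∷ xs) p⇒q y (there y∈) qy py with p x in px | q x in qx
  ... | true | true = s≤s (count-mono-< p q xs p⇒q y y∈ qy py)
  ... | true | false = contradiction (trans (sym (p⇒q x px)) qx) true≢false
  ... | false | true = m≤n⇒m≤1+n (count-mono-< p q xs p⇒q y y∈ qy py)
  ... | false | false = count-mono-< p q xs p⇒q y y∈ qy py

  count-cong : ∀ p q xs → (∀ x → p x ≡ q x) → count p xs ≡ count q xs
  count-cong p q [] p≗q = refl
  count-cong p q (x ∷ xs) p≗q rewrite p≗q x with q x
  ... | true = cong suc (count-cong p q xs p≗q)
  ... | false = count-cong p q xs p≗q

  count-∨-∧ : ∀ p q xs → count (λ x → p x ∨ q x) xs + count (λ x → p x ∧ q x) xs ≡ count p xs + count q xs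
  count-∨-∧ p q [] = refl
  count-∨-∧ p q (x ∷ xs) with p x | q x
  ... | true | true = cong suc (trans (+-suc _ _) (trans (cong suc (count-∨-∧ p q xs)) (sym (+-suc _ _))))
  ... | true | false = cong suc (count-∨-∧ p q xs)
  ... | false | true = trans (cong suc (count-∨-∧ p q xs)) (sym (+-suc _ _))
  ... | false | false = count-∨-∧ p q xs

  count-not : ∀ p xs → count p xs + count (λ x → not (p x)) xs ≡ length xs
  count-not p [] = refl
  count-not p (x ∷ xs) with p x
  ... | true = cong suc (count-not p xs)
  ... | false = trans (+-suc _ _) (cong suc (count-not p xs))

  count-++ : ∀ p xs ys → count p (xs ++ ys) ≡ count p xs + count p ys
  count-++ p [] ys = refl
  count-++ p (x ∷ xs) ys with p x
  ... | true = cong suc (count-++ p xs ys)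
  ... | false = count-++ p xs ys

  count-none : ∀ p xs → (∀ x → p x ≡ false) → count p xs ≡ 0
  count-none p [] none = refl
  count-none p (x ∷ xs) none rewrite none x = count-none p xs none

  count-∷-true : ∀ p {x} xs → p x ≡ true → count p (x ∷ xs) ≡ suc (count p xs)
  count-∷-true p xs px rewrite px = refl

  count-pos : ∀ p xs → 0 < count p xs → ∃ λ x → x ∈ xs × p x ≡ true
  count-pos p (x ∷ xs) pos with p x in px
  ... | true = x , here refl , px
  ... | false with count-pos p xs pos
  ... | y , y∈ , py = y , there y∈ , py

  count≥2 : ∀ p xs → 2 ≤ count p xs → Unique xs → ∃ λ x → ∃ λ y → x ≢ y × p x ≡ true × p y ≡ true
  count≥2 p (x ∷ xs) two (x∉ AllPairs.∷ u) with p x in px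
  ... | false = count≥2 p xs two u
  ... | true with count-pos p xs (≤-pred two)
  ... | y , y∈ , py = x , y , ∉⇒≢ x∉ y∈ , px , py

  count-≤-inj : ∀ p q (f : A → A) xs ys → Unique xs →
    (∀ x → x ∈ xs → p x ≡ true → f x ∈ ys × q (f x) ≡ true) →
    (∀ x y → x ∈ xs → y ∈ xs → p x ≡ true → p y ≡ true → f x ≡ f y → x ≡ y) →
    count p xs ≤ count q ys
  count-≤-inj p q f [] ys u maps inj = z≤n
  count-≤-inj p q f (x ∷ xs) ys (x∉ AllPairs.∷ u) maps inj with p x in px
  ... | false = count-≤-inj p q f xs ys u (λ z z∈ → maps z (there z∈)) (λ z w z∈ w∈ → inj z w (there z∈) (there w∈))
  ... | true with maps x (here refl) px
  ... | fx∈ , qfx with ∈-∃++ fx∈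
  ... | us , vs , refl = begin
      suc (count p xs)             ≤⟨ s≤s rest ⟩
      suc (count q (us ++ vs))     ≡⟨ cong suc (count-++ q us vs) ⟩
      suc (count q us + count q vs) ≡⟨ +-suc _ _ ⟨
      count q us + suc (count q vs) ≡⟨ cong (count q us +_) (count-∷-true q vs qfx) ⟨
      count q us + count q (f x ∷ vs) ≡⟨ count-++ q us (f x ∷ vs) ⟨
      count q (us ++ f x ∷ vs)     ∎
    where
      open ≤-Reasoning
      maps' : ∀ z → z ∈ xs → p z ≡ true → f z ∈ us ++ vs × q (f z) ≡ true
      maps' z z∈ pz with maps z (there z∈) pz
      ... | fz∈ , qfz with ∈-++⁻ us fz∈
      ... | inj₁ i = ∈-++⁺ˡ i , qfz
      ... | inj₂ (here fz≡fx) = ⊥-elim (∉⇒≢ x∉ z∈ (sym (inj z x (there z∈) (here refl) pz px fz≡fx)))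
      ... | inj₂ (there i) = ∈-++⁺ʳ us i , qfz
      rest : count p xs ≤ count q (us ++ vs)
      rest = count-≤-inj p q f xs (us ++ vs) u maps' (λ z w z∈ w∈ → inj z w (there z∈) (there w∈))

module Arithmetic where

  open ≤-Reasoning

  +-cancel-≤-both : ∀ m c {i j} → m + (i + c) ≤ m + (j + c) → i ≤ j
  +-cancel-≤-both m c {i} {j} h = +-cancelʳ-≤ c i j (+-cancelˡ-≤ m _ _ h)

  codegree-positive : ∀ {n k} c → 2 ≤ k → 2 * k < n → n ≤ c + suc (suc k) → 0 < c
  codegree-positive (suc c) _ _ _ = s≤s z≤n
  codegree-positive {n} {k} zero 2≤k large small =
    contradiction (≤-trans 2≤k (≤-pred (+-cancelˡ-≤ k _ _ k+k+1≤k+2))) λ { (s≤s ()) }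
    where
      k+k+1≤k+2 : k + suc k ≤ k + 2
      k+k+1≤k+2 = begin
        k + suc k     ≡⟨ solve (k ∷ []) ⟩
        suc (2 * k)   ≤⟨ large ⟩
        n             ≤⟨ small ⟩
        suc (suc k)   ≡⟨ +-comm 2 k ⟩
        k + 2         ∎

  three-codegrees⇒k≤4 : ∀ {n k a b c} →
    n ≤ a + suc (suc k) → n ≤ b + suc (suc k) → n ≤ c + suc (suc k) →
    a + b + c ≤ n → 2 * k < n → k ≤ 4
  three-codegrees⇒k≤4 {n} {k} {a} {b} {c} ha hb hc sum large = +-cancel-≤-both (n + 3 * k) 2 (begin
    n + 3 * k + (k + 2)                                       ≡⟨ solve (n ∷ k ∷ []) ⟩
    n + 2 * suc (2 * k)                                       ≤⟨ +-monoʳ-≤ n (*-monoʳ-≤ 2 large) ⟩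
    n + 2 * n                                                 ≡⟨ solve (n ∷ []) ⟩
    n + n + n                                                 ≤⟨ +-mono-≤ (+-mono-≤ ha hb) hc ⟩
    a + suc (suc k) + (b + suc (suc k)) + (c + suc (suc k))   ≡⟨ solve (a ∷ b ∷ c ∷ k ∷ []) ⟩
    a + b + c + 3 * suc (suc k)                               ≤⟨ +-monoˡ-≤ _ sum ⟩
    n + 3 * suc (suc k)                                       ≡⟨ solve (n ∷ k ∷ []) ⟩
    n + 3 * k + (4 + 2)                                       ∎)

  five-codegrees⇒k≤7 : ∀ {n k a b c d e} →
    n ≤ a + suc (suc k) → n ≤ b + suc (suc k) → n ≤ c + suc (suc k) →
    n ≤ d + suc (suc k) → n ≤ e + suc (suc k) →
    a + b + c + d + e ≤ n + n → 2 * k < n → k ≤ 7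
  five-codegrees⇒k≤7 {n} {k} {a} {b} {c} {d} {e} ha hb hc hd he sum large =
    +-cancel-≤-both (n + n + 5 * k) 3 (begin
      n + n + 5 * k + (k + 3)                           ≡⟨ solve (n ∷ k ∷ []) ⟩
      n + n + 3 * suc (2 * k)                           ≤⟨ +-monoʳ-≤ (n + n) (*-monoʳ-≤ 3 large) ⟩
      n + n + 3 * n                                     ≡⟨ solve (n ∷ []) ⟩
      n + n + n + n + n                                 ≤⟨ +-mono-≤ (+-mono-≤ (+-mono-≤ (+-mono-≤ ha hb) hc) hd) he ⟩
      a + suc (suc k) + (b + suc (suc k)) + (c + suc (suc k)) + (d + suc (suc k)) + (e + suc (suc k))
                                                        ≡⟨ solve (a ∷ b ∷ c ∷ d ∷ e ∷ k ∷ []) ⟩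
      a + b + c + d + e + 5 * suc (suc k)               ≤⟨ +-monoˡ-≤ _ sum ⟩
      n + n + 5 * suc (suc k)                           ≡⟨ solve (n ∷ k ∷ []) ⟩
      n + n + 5 * k + (7 + 3)                           ∎)

  two-unmatched : ∀ {n k P F} → n ≡ P + F + P → suc k ≤ P + F → n ≤ 2 * k → 2 ≤ F
  two-unmatched {n} {k} {P} {F} n≡ many small = +-cancelˡ-≤ (P + F + P) 2 F (begin
    P + F + P + 2      ≡⟨ cong (_+ 2) n≡ ⟨
    n + 2              ≤⟨ +-monoˡ-≤ 2 small ⟩
    2 * k + 2          ≡⟨ solve (k ∷ []) ⟩
    2 * suc k          ≤⟨ *-monoʳ-≤ 2 many ⟩
    2 * (P + F)        ≡⟨ solve (P ∷ F ∷ []) ⟩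
    P + F + P + F      ∎)

  few-colours : ∀ {n k P F} c → n ≡ P + F + P → n ≤ c + suc (suc k) → 2 + c ≤ P → P + F ≤ k
  few-colours {n} {k} {P} {F} c n≡ codeg missed = +-cancelˡ-≤ P _ _ (begin
    P + (P + F)         ≡⟨ solve (P ∷ F ∷ []) ⟩
    P + F + P           ≡⟨ n≡ ⟨
    n                   ≤⟨ codeg ⟩
    c + suc (suc k)     ≡⟨ solve (c ∷ k ∷ []) ⟩
    2 + c + k           ≤⟨ +-monoˡ-≤ k missed ⟩
    P + k               ∎)

module _ {n : ℕ} where

  open Counting

  _==_ : Fin n → Fin n → Bool
  x == y = does (x ≟ y)

  ==⇒≡ : ∀ {x y} → (x == y) ≡ true → x ≡ y
  ==⇒≡ {x} {y} e with x ≟ y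
  ... | yes x≡y = x≡y

  ≡⇒== : ∀ {x y} → x ≡ y → (x == y) ≡ true
  ≡⇒== {x} {y} = dec-true (x ≟ y)

  ==-false : ∀ {x y} → x ≢ y → (x == y) ≡ false
  ==-false {x} {y} = dec-false (x ≟ y)

  # : (Fin n → Bool) → ℕ
  # p = count p (allFin n)

  #-not : ∀ p → # p + # (λ x → not (p x)) ≡ n
  #-not p = trans (count-not p (allFin n)) (length-tabulate (λ x → x))

  #≤n : ∀ p → # p ≤ n
  #≤n p = ≤-trans (m≤m+n (# p) _) (≤-reflexive (#-not p))

  #-mono : ∀ p q → (∀ x → p x ≡ true → q x ≡ true) → # p ≤ # q
  #-mono p q = count-mono p q (allFin n)

  #-mono-< : ∀ p q → (∀ x → p x ≡ true → q x ≡ true) → ∀ y → q y ≡ true → p y ≡ false → # p < # q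
  #-mono-< p q p⇒q y = count-mono-< p q (allFin n) p⇒q y (∈-allFin y)

  #-cong : ∀ p q → (∀ x → p x ≡ q x) → # p ≡ # q
  #-cong p q = count-cong p q (allFin n)

  #-∨-∧ : ∀ p q → # (λ x → p x ∨ q x) + # (λ x → p x ∧ q x) ≡ # p + # q
  #-∨-∧ p q = count-∨-∧ p q (allFin n)

  #-∨-≤ : ∀ p q r → (∀ x → p x ≡ true → (q x ∨ r x) ≡ true) → # p ≤ # q + # r
  #-∨-≤ p q r p⇒q∨r = ≤-trans (#-mono p _ p⇒q∨r) (≤-trans (m≤m+n _ _) (≤-reflexive (#-∨-∧ q r)))

  #-none : ∀ p → (∀ x → p x ≡ false) → # p ≡ 0
  #-none p = count-none p (allFin n)

  #-disjoint-∨ : ∀ p q → (∀ x → (p x ∧ q x) ≡ false) → # (λ x → p x ∨ q x) ≡ # p + # q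
  #-disjoint-∨ p q disjoint = begin
    # (λ x → p x ∨ q x)                         ≡⟨ +-identityʳ _ ⟨
    # (λ x → p x ∨ q x) + 0                     ≡⟨ cong (# (λ x → p x ∨ q x) +_) (#-none _ disjoint) ⟨
    # (λ x → p x ∨ q x) + # (λ x → p x ∧ q x)   ≡⟨ #-∨-∧ p q ⟩
    # p + # q                                   ∎
    where open ≡-Reasoning

  #-≤-inj : ∀ p q (f : Fin n → Fin n) → (∀ x → p x ≡ true → q (f x) ≡ true) →
    (∀ x y → p x ≡ true → p y ≡ true → f x ≡ f y → x ≡ y) → # p ≤ # q
  #-≤-inj p q f maps inj = count-≤-inj p q f (allFin n) (allFin n) (allFin⁺ n)
    (λ x _ px → ∈-allFin (f x) , maps x px) (λ x y _ _ → inj x y)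

  #-singleton : ∀ v → # (_== v) ≤ 1
  #-singleton v = count-≤-inj (_== v) (λ _ → true) (λ _ → v) (allFin n) (v ∷ []) (allFin⁺ n)
    (λ _ _ _ → here refl , refl) (λ x y _ _ x≡v y≡v _ → trans (==⇒≡ x≡v) (sym (==⇒≡ y≡v)))

  #-pos : ∀ p → 0 < # p → ∃ λ x → p x ≡ true
  #-pos p pos with count-pos p (allFin n) pos
  ... | x , _ , px = x , px

  #≥2 : ∀ p → 2 ≤ # p → ∃ λ x → ∃ λ y → x ≢ y × p x ≡ true × p y ≡ true
  #≥2 p two = count≥2 p (allFin n) two (allFin⁺ n)

  #-two-missing : ∀ p q → (∀ x → p x ≡ true → q x ≡ true) → ∀ {a b} → a ≢ b →
    q a ≡ true → q b ≡ true → p a ≡ false → p b ≡ false → 2 + # p ≤ # q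
  #-two-missing p q p⇒q {a} {b} a≢b qa qb pa pb =
    ≤-trans (s≤s (#-mono-< p p+a (λ x px → ∨-introˡ _ px) a (∨-introʳ (p a) (≡⇒== {a} refl)) pa))
            (#-mono-< p+a q p+a⇒q b qb (cong₂ _∨_ pb (==-false (a≢b ∘ sym))))
    where
      p+a : Fin n → Bool
      p+a x = p x ∨ (x == a)
      p+a⇒q : ∀ x → p+a x ≡ true → q x ≡ true
      p+a⇒q x e with ∨-elim e
      ... | inj₁ px = p⇒q x px
      ... | inj₂ x≡a = subst (λ t → q t ≡ true) (sym (==⇒≡ x≡a)) qa

  Independent : (Fin n → Fin n → Bool) → (Fin n → Bool) → Set
  Independent H S = ∀ x y → S x ≡ true → S y ≡ true → H x y ≡ true → ⊥

  anyᵇ : (Fin n → Bool) → Bool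
  anyᵇ q = does (any? λ x → q x Bool.≟ true)

  anyᵇ-intro : ∀ q x → q x ≡ true → anyᵇ q ≡ true
  anyᵇ-intro q x qx = dec-true (any? λ x → q x Bool.≟ true) (x , qx)

  anyᵇ-elim : ∀ q → anyᵇ q ≡ true → ∃ λ x → q x ≡ true
  anyᵇ-elim q e with any? (λ x → q x Bool.≟ true)
  ... | yes ∃x = ∃x

module Involution {n : ℕ} (p : Fin n → Fin n) (p-invol : ∀ x → p (p x) ≡ x) where

  p-injective : ∀ {a b} → p a ≡ p b → a ≡ b
  p-injective {a} {b} e = trans (sym (p-invol a)) (trans (cong p e) (p-invol b))

  p-moves : ∀ {z} → p z ≢ z → p (p z) ≢ p z
  p-moves {z} pz≢z e = pz≢z (trans (sym e) (p-invol z))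

  fixed : Fin n → Bool
  fixed z = p z == z

  lower : Fin n → Bool
  lower z = toℕ z <ᵇ toℕ (p z)

  upper : Fin n → Bool
  upper z = toℕ (p z) <ᵇ toℕ z

  isRep : Fin n → Bool
  isRep z = lower z ∨ fixed z

  fixed⇒≡ : ∀ {z} → fixed z ≡ true → p z ≡ z
  fixed⇒≡ = ==⇒≡

  ≡⇒fixed : ∀ {z} → p z ≡ z → fixed z ≡ true
  ≡⇒fixed = ≡⇒==

  ≢⇒unfixed : ∀ {z} → p z ≢ z → fixed z ≡ false
  ≢⇒unfixed = ==-false

  data Kind (z : Fin n) : Set where
    lowerKind : lower z ≡ true → fixed z ≡ false → upper z ≡ false → p z ≢ z → Kind z
    fixedKind : lower z ≡ false → fixed z ≡ true → upper z ≡ false → p z ≡ z → Kind z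
    upperKind : lower z ≡ false → fixed z ≡ false → upper z ≡ true → p z ≢ z → Kind z

  kind : ∀ z → Kind z
  kind z with <-cmp (toℕ z) (toℕ (p z))
  ... | tri< z<pz z≢pz _ = lowerKind (<ᵇ-true z<pz) (≢⇒unfixed pz≢z) (<ᵇ-false (<⇒≯ z<pz)) pz≢z
    where pz≢z = λ e → z≢pz (sym (cong toℕ e))
  ... | tri≈ z≮pz z≡pz pz≮z = fixedKind (<ᵇ-false z≮pz) (≡⇒fixed pz≡z) (<ᵇ-false pz≮z) pz≡z
    where pz≡z = sym (toℕ-injective z≡pz)
  ... | tri> _ z≢pz pz<z = upperKind (<ᵇ-false (<⇒≯ pz<z)) (≢⇒unfixed pz≢z) (<ᵇ-true pz<z) pz≢z
    where pz≢z = λ e → z≢pz (sym (cong toℕ e))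

  lower⇒moves : ∀ {z} → lower z ≡ true → p z ≢ z
  lower⇒moves {z} low with kind z
  ... | lowerKind _ _ _ pz≢z = pz≢z
  ... | fixedKind nlow _ _ _ = contradiction (trans (sym low) nlow) true≢false
  ... | upperKind nlow _ _ _ = contradiction (trans (sym low) nlow) true≢false

  #pairs : ℕ
  #pairs = # lower

  #fixed : ℕ
  #fixed = # fixed

  #lower≡#upper : # lower ≡ # upper
  #lower≡#upper = ≤-antisym (#-≤-inj lower upper p lower⇒upper (λ x y _ _ → p-injective))
                            (#-≤-inj upper lower p upper⇒lower (λ x y _ _ → p-injective))
    where
      lower⇒upper : ∀ x → lower x ≡ true → upper (p x) ≡ true
      lower⇒upper x low rewrite p-invol x = low
      upper⇒lower : ∀ x → upper x ≡ true → lower (p x) ≡ true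
      upper⇒lower x up rewrite p-invol x = up

  #isRep : # isRep ≡ #pairs + #fixed
  #isRep = #-disjoint-∨ lower fixed disjoint
    where
      disjoint : ∀ z → (lower z ∧ fixed z) ≡ false
      disjoint z with kind z
      ... | lowerKind _ unfix _ _ = trans (cong (lower z ∧_) unfix) (∧-zeroʳ (lower z))
      ... | fixedKind nlow _ _ _ = cong (_∧ fixed z) nlow
      ... | upperKind nlow _ _ _ = cong (_∧ fixed z) nlow

  order≡ : n ≡ #pairs + #fixed + #pairs
  order≡ = begin
    n                                  ≡⟨ #-not isRep ⟨
    # isRep + # (λ z → not (isRep z))  ≡⟨ cong₂ _+_ #isRep (#-cong _ upper notRep≡upper) ⟩
    #pairs + #fixed + # upper          ≡⟨ cong (#pairs + #fixed +_) #lower≡#upper ⟨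
    #pairs + #fixed + #pairs           ∎
    where
      open ≡-Reasoning
      notRep≡upper : ∀ z → not (isRep z) ≡ upper z
      notRep≡upper z with kind z
      ... | lowerKind low _ up _ rewrite low | up = refl
      ... | fixedKind low fix up _ rewrite low | fix | up = refl
      ... | upperKind low fix up _ rewrite low | fix | up = refl

  rep : Fin n → Fin n
  rep z = if isRep z then z else p z

  rep-cases : ∀ z → rep z ≡ z ⊎ rep z ≡ p z
  rep-cases z with isRep z
  ... | true = inj₁ refl
  ... | false = inj₂ refl

  rep-isRep : ∀ z → isRep (rep z) ≡ true
  rep-isRep z with isRep z in isRepz
  ... | true = isRepz
  ... | false with kind z
  ... | lowerKind low _ _ _ = contradiction (trans (sym (∨-introˡ (fixed z) low)) isRepz) true≢false
  ... | fixedKind _ fix _ _ = contradiction (trans (sym (∨-introʳ (lower z) fix)) isRepz) true≢false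
  ... | upperKind _ _ up _ = ∨-introˡ (fixed (p z)) (subst (λ w → (toℕ (p z) <ᵇ toℕ w) ≡ true) (sym (p-invol z)) up)

  rep-≡ : ∀ a b → rep a ≡ rep b → a ≡ b ⊎ a ≡ p b
  rep-≡ a b e with rep-cases a | rep-cases b
  ... | inj₁ ra | inj₁ rb = inj₁ (trans (sym ra) (trans e rb))
  ... | inj₁ ra | inj₂ rb = inj₂ (trans (sym ra) (trans e rb))
  ... | inj₂ ra | inj₁ rb = inj₂ (trans (sym (p-invol a)) (cong p (trans (sym ra) (trans e rb))))
  ... | inj₂ ra | inj₂ rb = inj₁ (p-injective (trans (sym ra) (trans e rb)))

  rank : Fin n → ℕ
  rank z = # (λ y → isRep y ∧ (toℕ y <ᵇ toℕ z))

  rank<#isRep : ∀ z → isRep z ≡ true → rank z < # isRep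
  rank<#isRep z rz = #-mono-< _ isRep (λ y e → proj₁ (∧-true e)) z rz
    (trans (cong (isRep z ∧_) (<ᵇ-false (n≮n (toℕ z)))) (∧-zeroʳ (isRep z)))

  rank-mono : ∀ a b → isRep a ≡ true → toℕ a < toℕ b → rank a < rank b
  rank-mono a b ra a<b = #-mono-< _ _ mono a (trans (cong (_∧ _) ra) (<ᵇ-true a<b))
    (trans (cong (isRep a ∧_) (<ᵇ-false (n≮n (toℕ a)))) (∧-zeroʳ (isRep a)))
    where
      mono : ∀ y → (isRep y ∧ (toℕ y <ᵇ toℕ a)) ≡ true → (isRep y ∧ (toℕ y <ᵇ toℕ b)) ≡ true
      mono y e with ∧-true {isRep y} e
      ... | ry , y<a = trans (cong (_∧ _) ry) (<ᵇ-true (<-trans (<ᵇ⇒<′ y<a) a<b))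

  rank-injective : ∀ a b → isRep a ≡ true → isRep b ≡ true → rank a ≡ rank b → a ≡ b
  rank-injective a b ra rb e with <-cmp (toℕ a) (toℕ b)
  ... | tri< a<b _ _ = contradiction e (<⇒≢ (rank-mono a b ra a<b))
  ... | tri≈ _ a≡b _ = toℕ-injective a≡b
  ... | tri> _ _ b<a = contradiction (sym e) (<⇒≢ (rank-mono b a rb b<a))

  orbitColouring : ∀ {k} → # isRep ≤ k →
    Σ (Fin n → Fin k) λ c → ∀ u v → c u ≡ c v → u ≡ v ⊎ u ≡ p v
  orbitColouring #isRep≤k = c , λ u v cu≡cv → rep-≡ u v (rank-injective _ _ (rep-isRep u) (rep-isRep v)
      (trans (sym (toℕ-fromℕ< _)) (trans (cong toℕ cu≡cv) (toℕ-fromℕ< _))))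
    where
      c : Fin n → Fin _
      c z = fromℕ< (<-≤-trans (rank<#isRep (rep z) (rep-isRep z)) #isRep≤k)

  moving-rep⇒lower : ∀ {a} → p a ≢ a → isRep a ≡ true → lower a ≡ true
  moving-rep⇒lower {a} pa≢a ra with kind a
  ... | lowerKind low _ _ _ = low
  ... | fixedKind _ _ _ pa≡a = contradiction pa≡a pa≢a
  ... | upperKind nlow unfix _ _ = contradiction (trans (sym ra) (cong₂ _∨_ nlow unfix)) true≢false

  one-rep-per-pair : ∀ {a} → p a ≢ a → isRep a ≡ true → isRep (p a) ≡ true → ⊥
  one-rep-per-pair {a} pa≢a ra rpa = <-asym (<ᵇ⇒<′ (moving-rep⇒lower pa≢a ra))
    (subst (λ t → toℕ (p a) < toℕ t) (p-invol a) (<ᵇ⇒<′ (moving-rep⇒lower (p-moves pa≢a) rpa)))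

  rep-p : ∀ z → rep (p z) ≡ rep z
  rep-p z with rep-cases z | rep-cases (p z)
  ... | inj₁ rz | inj₁ rpz = trans rpz (trans (pair-fixed rz rpz (p z ≟ z)) (sym rz))
    where
      pair-fixed : rep z ≡ z → rep (p z) ≡ p z → Dec (p z ≡ z) → p z ≡ z
      pair-fixed rz rpz (yes pz≡z) = pz≡z
      pair-fixed rz rpz (no pz≢z) = ⊥-elim (one-rep-per-pair pz≢z (subst (λ t → isRep t ≡ true) rz (rep-isRep z))
                                                                 (subst (λ t → isRep t ≡ true) rpz (rep-isRep (p z))))
  ... | inj₁ rz | inj₂ rpz = trans rpz (trans (p-invol z) (sym rz))
  ... | inj₂ rz | inj₁ rpz = trans rpz (sym rz)
  ... | inj₂ rz | inj₂ rpz = trans rpz (trans (p-invol z) (sym (trans rz (pair-fixed rz rpz (p z ≟ z)))))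
    where
      pair-fixed : rep z ≡ p z → rep (p z) ≡ p (p z) → Dec (p z ≡ z) → p z ≡ z
      pair-fixed rz rpz (yes pz≡z) = pz≡z
      pair-fixed rz rpz (no pz≢z) = ⊥-elim (one-rep-per-pair pz≢z
        (subst (λ t → isRep t ≡ true) (trans rpz (p-invol z)) (rep-isRep (p z)))
        (subst (λ t → isRep t ≡ true) rz (rep-isRep z)))

  rep-moves : ∀ {z} → p z ≢ z → p (rep z) ≢ rep z
  rep-moves {z} pz≢z with rep-cases z
  ... | inj₁ rz = subst (λ t → p t ≢ t) (sym rz) pz≢z
  ... | inj₂ rz = subst (λ t → p t ≢ t) (sym rz) (p-moves pz≢z)

  rep-lower : ∀ {z} → p z ≢ z → lower (rep z) ≡ true
  rep-lower {z} pz≢z = moving-rep⇒lower (rep-moves pz≢z) (rep-isRep z)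

  lower⇒rep≡ : ∀ {e} → lower e ≡ true → rep e ≡ e
  lower⇒rep≡ {e} low rewrite low = refl

rematch : ∀ {n} → (Fin n → Fin n) → Fin n → Fin n → Fin n → Fin n
rematch p x y z with z ≟ x
... | yes _ = y
... | no _ with z ≟ y
... | yes _ = x
... | no _ with z ≟ p x
... | yes _ = z
... | no _ with z ≟ p y
... | yes _ = z
... | no _ = p z

module Rematch {n} (p : Fin n → Fin n) (p-invol : ∀ x → p (p x) ≡ x) {x y : Fin n} (x≢y : x ≢ y) where

  open Involution p p-invol using (p-injective)

  rematch-x : rematch p x y x ≡ y
  rematch-x with x ≟ x
  ... | yes _ = refl
  ... | no x≢x = contradiction refl x≢x

  rematch-y : rematch p x y y ≡ x
  rematch-y with y ≟ x
  ... | yes y≡x = contradiction (sym y≡x) x≢y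
  ... | no _ with y ≟ y
  ... | yes _ = refl
  ... | no y≢y = contradiction refl y≢y

  rematch-abandoned : ∀ {z} → z ≢ x → z ≢ y → z ≡ p x ⊎ z ≡ p y → rematch p x y z ≡ z
  rematch-abandoned {z} z≢x z≢y abandoned with z ≟ x
  ... | yes z≡x = contradiction z≡x z≢x
  ... | no _ with z ≟ y
  ... | yes z≡y = contradiction z≡y z≢y
  ... | no _ with z ≟ p x
  ... | yes _ = refl
  ... | no z≢px with z ≟ p y
  ... | yes _ = refl
  ... | no z≢py with abandoned
  ... | inj₁ z≡px = contradiction z≡px z≢px
  ... | inj₂ z≡py = contradiction z≡py z≢py

  rematch-other : ∀ {z} → z ≢ x → z ≢ y → z ≢ p x → z ≢ p y → rematch p x y z ≡ p z
  rematch-other {z} z≢x z≢y z≢px z≢py with z ≟ x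
  ... | yes z≡x = contradiction z≡x z≢x
  ... | no _ with z ≟ y
  ... | yes z≡y = contradiction z≡y z≢y
  ... | no _ with z ≟ p x
  ... | yes z≡px = contradiction z≡px z≢px
  ... | no _ with z ≟ p y
  ... | yes z≡py = contradiction z≡py z≢py
  ... | no _ = refl

  data Position (z : Fin n) : Set where
    atX : z ≡ x → Position z
    atY : z ≡ y → Position z
    abandoned : z ≢ x → z ≢ y → z ≡ p x ⊎ z ≡ p y → Position z
    other : z ≢ x → z ≢ y → z ≢ p x → z ≢ p y → Position z

  position : ∀ z → Position z
  position z with z ≟ x
  ... | yes z≡x = atX z≡x
  ... | no z≢x with z ≟ y
  ... | yes z≡y = atY z≡y
  ... | no z≢y with z ≟ p x
  ... | yes z≡px = abandoned z≢x z≢y (inj₁ z≡px)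
  ... | no z≢px with z ≟ p y
  ... | yes z≡py = abandoned z≢x z≢y (inj₂ z≡py)
  ... | no z≢py = other z≢x z≢y z≢px z≢py

  rematch-invol : ∀ z → rematch p x y (rematch p x y z) ≡ z
  rematch-invol z with position z
  ... | atX refl = trans (cong (rematch p x y) rematch-x) rematch-y
  ... | atY refl = trans (cong (rematch p x y) rematch-y) rematch-x
  ... | abandoned z≢x z≢y ab = trans (cong (rematch p x y) (rematch-abandoned z≢x z≢y ab)) (rematch-abandoned z≢x z≢y ab)
  ... | other z≢x z≢y z≢px z≢py = begin
      rematch p x y (rematch p x y z)   ≡⟨ cong (rematch p x y) (rematch-other z≢x z≢y z≢px z≢py) ⟩
      rematch p x y (p z)               ≡⟨ rematch-other (z≢px ∘ partner-eq) (z≢py ∘ partner-eq)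
                                                         (z≢x ∘ p-injective) (z≢y ∘ p-injective) ⟩
      p (p z)                           ≡⟨ p-invol z ⟩
      z                                 ∎
    where
      open ≡-Reasoning
      partner-eq : ∀ {w} → p z ≡ w → z ≡ p w
      partner-eq {w} pz≡w = trans (sym (p-invol z)) (cong p pz≡w)

  rematch-fixed : ∀ z → rematch p x y z ≡ z → z ≢ x × z ≢ y × (z ≡ p x ⊎ z ≡ p y ⊎ p z ≡ z)
  rematch-fixed z fix with position z
  ... | atX refl = contradiction (trans (sym fix) rematch-x) x≢y
  ... | atY refl = contradiction (trans (sym rematch-y) fix) x≢y
  ... | abandoned z≢x z≢y (inj₁ z≡px) = z≢x , z≢y , inj₁ z≡px
  ... | abandoned z≢x z≢y (inj₂ z≡py) = z≢x , z≢y , inj₂ (inj₁ z≡py)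
  ... | other z≢x z≢y z≢px z≢py = z≢x , z≢y , inj₂ (inj₂ (trans (sym (rematch-other z≢x z≢y z≢px z≢py)) fix))

module Matchings {n : ℕ} (H : Fin n → Fin n → Bool)
                 (H-sym : ∀ {x y} → H x y ≡ true → H y x ≡ true)
                 (H-irrefl : ∀ x → H x x ≡ false) where

  H⇒≢ : ∀ {x y} → H x y ≡ true → x ≢ y
  H⇒≢ {x} Hxy refl = true≢false (trans (sym Hxy) (H-irrefl x))

  record Matching : Set where
    field
      partner : Fin n → Fin n
      partner-invol : ∀ x → partner (partner x) ≡ x
      partner-adj : ∀ x → partner x ≢ x → H x (partner x) ≡ true

  noMatching : Matching
  noMatching = record { partner = λ x → x ; partner-invol = λ _ → refl ; partner-adj = λ x x≢x → contradiction refl x≢x }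

  matchEdge : Matching → ∀ {x y} → H x y ≡ true → Matching
  matchEdge M {x} {y} Hxy = record
    { partner = rematch partner x y
    ; partner-invol = rematch-invol
    ; partner-adj = adj }
    where
      open Matching M
      open Rematch partner partner-invol (H⇒≢ Hxy)
      adj : ∀ z → rematch partner x y z ≢ z → H z (rematch partner x y z) ≡ true
      adj z moved with position z
      ... | atX refl = subst (λ t → H x t ≡ true) (sym rematch-x) Hxy
      ... | atY refl = subst (λ t → H y t ≡ true) (sym rematch-y) (H-sym Hxy)
      ... | abandoned z≢x z≢y ab = contradiction (rematch-abandoned z≢x z≢y ab) moved
      ... | other z≢x z≢y z≢px z≢py = subst (λ t → H z t ≡ true) (sym (rematch-other z≢x z≢y z≢px z≢py))
                                        (partner-adj z (moved ∘ trans (rematch-other z≢x z≢y z≢px z≢py)))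

  -- s – a₁ = p a₁ – a₂ = p a₂ – … – t with H-edges – and matching edges =, ending at a free t.
  AlternatingPath : (Fin n → Fin n) → Fin n → List (Fin n) → Fin n → Set
  AlternatingPath p s [] t = p t ≡ t × H s t ≡ true
  AlternatingPath p s (a ∷ as) t =
    p a ≢ a × H s a ≡ true × All (λ a′ → a′ ≢ a × a′ ≢ p a) as × AlternatingPath p (p a) as t

  path-end-free : ∀ p s as t → AlternatingPath p s as t → p t ≡ t
  path-end-free p s [] t (pt≡t , _) = pt≡t
  path-end-free p s (a ∷ as) t (_ , _ , _ , path) = path-end-free p (p a) as t path

  path-inner-matched : ∀ p s as t → AlternatingPath p s as t → All (λ a → p a ≢ a) as
  path-inner-matched p s [] t _ = All.[]
  path-inner-matched p s (a ∷ as) t (pa≢a , _ , _ , path) = pa≢a All.∷ path-inner-matched p (p a) as t path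

  path-transfer : ∀ p q s as t → All (λ a → q a ≡ p a) as → q t ≡ t →
                  AlternatingPath p s as t → AlternatingPath q s as t
  path-transfer p q s [] t All.[] qt≡t (_ , Hst) = qt≡t , Hst
  path-transfer p q s (a ∷ as) t (qa≡pa All.∷ agree) qt≡t (pa≢a , Hsa , fresh , path) =
    pa≢a ∘ trans (sym qa≡pa) , Hsa ,
    All.map (λ { (a′≢a , a′≢pa) → a′≢a , a′≢pa ∘ (λ e → trans e qa≡pa) }) fresh ,
    subst (λ r → AlternatingPath q r as t) (sym qa≡pa) (path-transfer p q (p a) as t agree qt≡t path)

  FixedPointsShrink : Matching → Matching → Fin n → Set
  FixedPointsShrink M′ M s = ∀ z → Matching.partner M′ z ≡ z → Matching.partner M z ≡ z × z ≢ s

  augment : (M : Matching) → ∀ s as t → Matching.partner M s ≡ s → s ≢ t →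
            AlternatingPath (Matching.partner M) s as t → Σ Matching λ M′ → FixedPointsShrink M′ M s
  augment M s [] t ps≡s s≢t (pt≡t , Hst) = matchEdge M Hst , shrink
    where
      open Matching M
      shrink : FixedPointsShrink (matchEdge M Hst) M s
      shrink z fix with Rematch.rematch-fixed partner partner-invol s≢t z fix
      ... | z≢s , z≢t , inj₁ z≡ps = contradiction (trans z≡ps ps≡s) z≢s
      ... | z≢s , z≢t , inj₂ (inj₁ z≡pt) = contradiction (trans z≡pt pt≡t) z≢t
      ... | z≢s , z≢t , inj₂ (inj₂ pz≡z) = pz≡z , z≢s
  augment M s (a ∷ as) t ps≡s s≢t (pa≢a , Hsa , fresh , path) = proj₁ rest , shrink
    where
      open Matching M
      open Involution partner partner-invol using (p-moves)
      open Rematch partner partner-invol (H⇒≢ Hsa)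
      M₁ = matchEdge M Hsa
      p₁ = Matching.partner M₁
      fixed≢moving : ∀ {u v} → partner u ≡ u → partner v ≢ v → u ≢ v
      fixed≢moving pu≡u pv≢v refl = pv≢v pu≡u
      pt≡t : partner t ≡ t
      pt≡t = path-end-free partner (partner a) as t path
      agree : All (λ a′ → p₁ a′ ≡ partner a′) as
      agree = All.zipWith
        (λ { (pa′≢a′ , (a′≢a , a′≢pa)) →
          rematch-other (fixed≢moving ps≡s pa′≢a′ ∘ sym) a′≢a
                        (fixed≢moving ps≡s pa′≢a′ ∘ sym ∘ (λ e → trans e ps≡s)) a′≢pa })
        (path-inner-matched partner (partner a) as t path , fresh)
      p₁t≡t : p₁ t ≡ t
      p₁t≡t = trans (rematch-other (s≢t ∘ sym) (fixed≢moving pt≡t pa≢a) (s≢t ∘ sym ∘ (λ e → trans e ps≡s))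
                                   (fixed≢moving pt≡t (p-moves pa≢a))) pt≡t
      p₁pa≡pa : p₁ (partner a) ≡ partner a
      p₁pa≡pa = rematch-abandoned (fixed≢moving ps≡s (p-moves pa≢a) ∘ sym)
                                  (pa≢a ∘ (λ e → trans (cong partner (sym e)) (partner-invol a))) (inj₂ refl)
      rest = augment M₁ (partner a) as t p₁pa≡pa (fixed≢moving pt≡t (p-moves pa≢a) ∘ sym)
                     (path-transfer partner p₁ (partner a) as t agree p₁t≡t path)
      shrink : FixedPointsShrink (proj₁ rest) M s
      shrink z fix with proj₂ rest z fix
      ... | p₁z≡z , z≢pa with rematch-fixed z p₁z≡z
      ... | z≢s , _ , inj₁ z≡ps = contradiction (trans z≡ps ps≡s) z≢s
      ... | _ , _ , inj₂ (inj₁ z≡pa) = contradiction z≡pa z≢pa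
      ... | z≢s , _ , inj₂ (inj₂ pz≡z) = pz≡z , z≢s

  #unmatched : Matching → ℕ
  #unmatched M = # (λ z → Matching.partner M z == z)

  shrink⇒#unmatched< : ∀ {M′ M s} → FixedPointsShrink M′ M s → Matching.partner M s ≡ s → #unmatched M′ < #unmatched M
  shrink⇒#unmatched< {M′} {M} {s} shrink ps≡s = #-mono-< _ _
    (λ z fix′ → ≡⇒== (proj₁ (shrink z (==⇒≡ fix′))))
    s (≡⇒== ps≡s) (==-false (λ p′s≡s → proj₂ (shrink s p′s≡s) refl))

module TriangleFree {n : ℕ} (H : Fin n → Fin n → Bool)
  (H-sym : ∀ {x y} → H x y ≡ true → H y x ≡ true)
  (H-irrefl : ∀ x → H x x ≡ false)
  (triangle-free : ∀ {x y z} → H x y ≡ true → H y z ≡ true → H x z ≡ true → ⊥)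
  (k : ℕ) (8≤k : 8 ≤ k)
  (degree-lower-bound : ∀ v → n ≤ # (H v) + suc (suc k))
  (independence-bound : ∀ S → Independent H S → # S ≤ k)
  where

  open Arithmetic

  k≰7 : ¬ k ≤ 7
  k≰7 = <⇒≱ 8≤k

  neighbourhoods-disjoint : ∀ {v w} → H v w ≡ true → ∀ z → (H w z ∧ H v z) ≡ false
  neighbourhoods-disjoint {v} {w} Hvw z with H w z in Hwz | H v z in Hvz
  ... | true | true = ⊥-elim (triangle-free Hvw Hwz Hvz)
  ... | true | false = refl
  ... | false | _ = refl

  avoids : (Fin n → Bool) → Fin n → Bool
  avoids Y z = not (anyᵇ (λ y → Y y ∧ H z y))

  avoids-nbr : ∀ {Y z t} → avoids Y z ≡ true → H z t ≡ true → Y t ≡ false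
  avoids-nbr {Y} {z} {t} avoid Hzt with Y t in Yt
  ... | false = refl
  ... | true = ⊥-elim (not-¬ (not-true avoid) (anyᵇ-intro _ t (trans (cong (_∧ H z t) Yt) Hzt)))

  module LargeOrder (large : 2 * k < n) where

    avoiding-large-independent : ∀ Y → n ≤ # Y + suc (suc k) → Independent H (avoids Y)
    avoiding-large-independent Y degY z z′ avoid avoid′ Hzz′ = k≰7
      (≤-trans (three-codegrees⇒k≤4 (degree-lower-bound z) (degree-lower-bound z′) degY sum large) (m≤m+n 4 3))
      where
        sum : # (H z) + # (H z′) + # Y ≤ n
        sum = begin
          # (H z) + # (H z′) + # Y                   ≡⟨ cong (_+ # Y) (#-disjoint-∨ (H z) (H z′) disjoint) ⟨
          # (λ t → H z t ∨ H z′ t) + # Y             ≤⟨ +-monoˡ-≤ (# Y) (#-mono _ _ outside) ⟩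
          # (λ t → not (Y t)) + # Y                  ≡⟨ +-comm _ (# Y) ⟩
          # Y + # (λ t → not (Y t))                  ≡⟨ #-not Y ⟩
          n                                          ∎
          where
            open ≤-Reasoning
            disjoint = neighbourhoods-disjoint (H-sym Hzz′)
            outside : ∀ t → (H z t ∨ H z′ t) ≡ true → not (Y t) ≡ true
            outside t e with ∨-elim e
            ... | inj₁ Hzt = cong not (avoids-nbr avoid Hzt)
            ... | inj₂ Hz′t = cong not (avoids-nbr avoid′ Hz′t)

    module _ {v w} (Hvw : H v w ≡ true) where

      -- Five degree lower bounds against a total of 2n: this is where k ≥ 8 is needed.
      no-vertex-sees-both : ∀ {z x y} → H w x ≡ true → H z x ≡ true → H v y ≡ true → H z y ≡ true → ⊥
      no-vertex-sees-both {z} {x} {y} Hwx Hzx Hvy Hzy = k≰7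
        (five-codegrees⇒k≤7 (degree-lower-bound x) (degree-lower-bound y) (degree-lower-bound z)
                            (degree-lower-bound w) (degree-lower-bound v) sum large)
        where
          A B : Fin n → Bool
          A t = not (H z t) ∧ not (H w t)
          B t = not (H z t) ∧ not (H v t)
          unseen : ∀ {a b t} → H a b ≡ true → H b t ≡ true → not (H a t) ≡ true
          unseen {a} {b} {t} Hab Hbt with H a t in Hat
          ... | true = ⊥-elim (triangle-free Hab Hbt Hat)
          ... | false = refl
          Nx⊆A : ∀ t → H x t ≡ true → A t ≡ true
          Nx⊆A t Hxt = cong₂ _∧_ (unseen Hzx Hxt) (unseen Hwx Hxt)
          Ny⊆B : ∀ t → H y t ≡ true → B t ≡ true
          Ny⊆B t Hyt = cong₂ _∧_ (unseen Hzy Hyt) (unseen Hvy Hyt)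
          A∨B⊆ : ∀ t → (A t ∨ B t) ≡ true → not (H z t) ≡ true
          A∨B⊆ t e with H z t
          ... | false = refl
          A∧B⊆ : ∀ t → (A t ∧ B t) ≡ true → not (H w t ∨ H v t) ≡ true
          A∧B⊆ t e with H z t | H w t | H v t
          ... | false | false | false = refl
          rearrange : ∀ a b c d e → a + b + c + d + e ≡ c + a + (d + e + b)
          rearrange = solve-∀
          sum : # (H x) + # (H y) + # (H z) + # (H w) + # (H v) ≤ n + n
          sum = begin
            # (H x) + # (H y) + # (H z) + # (H w) + # (H v)
              ≤⟨ +-monoˡ-≤ _ (+-monoˡ-≤ _ (+-monoˡ-≤ _ (+-mono-≤ (#-mono _ A Nx⊆A) (#-mono _ B Ny⊆B)))) ⟩
            # A + # B + # (H z) + # (H w) + # (H v)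
              ≡⟨ cong (λ m → m + # (H z) + # (H w) + # (H v)) (#-∨-∧ A B) ⟨
            # (λ t → A t ∨ B t) + # (λ t → A t ∧ B t) + # (H z) + # (H w) + # (H v)
              ≤⟨ +-monoˡ-≤ _ (+-monoˡ-≤ _ (+-monoˡ-≤ _ (+-mono-≤ (#-mono _ _ A∨B⊆) (#-mono _ _ A∧B⊆)))) ⟩
            # (λ t → not (H z t)) + # (λ t → not (H w t ∨ H v t)) + # (H z) + # (H w) + # (H v)
              ≡⟨ rearrange (# (λ t → not (H z t))) (# (λ t → not (H w t ∨ H v t))) (# (H z)) (# (H w)) (# (H v)) ⟩
            # (H z) + # (λ t → not (H z t)) + (# (H w) + # (H v) + # (λ t → not (H w t ∨ H v t)))
              ≡⟨ cong₂ _+_ (#-not (H z)) total-wv ⟩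
            n + n ∎
            where
              open ≤-Reasoning
              total-wv : # (H w) + # (H v) + # (λ t → not (H w t ∨ H v t)) ≡ n
              total-wv = trans (cong (_+ # (λ t → not (H w t ∨ H v t)))
                                     (sym (#-disjoint-∨ (H w) (H v) (neighbourhoods-disjoint Hvw))))
                               (#-not (λ t → H w t ∨ H v t))

      avoids-one-side : ∀ z → (avoids (H w) z ∨ avoids (H v) z) ≡ true
      avoids-one-side z with anyᵇ (λ x → H w x ∧ H z x) in seesX | anyᵇ (λ y → H v y ∧ H z y) in seesY
      ... | false | _ = refl
      ... | true | false = refl
      ... | true | true with anyᵇ-elim (λ x → H w x ∧ H z x) seesX | anyᵇ-elim (λ y → H v y ∧ H z y) seesY
      ... | x , wxz | y , vyz = ⊥-elim (no-vertex-sees-both (proj₁ (∧-true {H w x} wxz)) (proj₂ (∧-true {H w x} wxz))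
                                                           (proj₁ (∧-true {H v y} vyz)) (proj₂ (∧-true {H v y} vyz)))

      order≤2k : n ≤ 2 * k
      order≤2k = begin
        n                                                   ≡⟨ #-not (avoids (H w)) ⟨
        # (avoids (H w)) + # (λ z → not (avoids (H w) z))   ≤⟨ +-monoʳ-≤ _ (#-mono _ _ other-side) ⟩
        # (avoids (H w)) + # (avoids (H v))                 ≤⟨ +-mono-≤ (bound w) (bound v) ⟩
        k + k                                               ≡⟨ cong (k +_) (+-identityʳ k) ⟨
        2 * k                                               ∎
        where
          open ≤-Reasoning
          other-side : ∀ z → not (avoids (H w) z) ≡ true → avoids (H v) z ≡ true
          other-side z e with avoids (H w) z | avoids-one-side z
          ... | false | side = side
          bound : ∀ u → # (avoids (H u)) ≤ k
          bound u = independence-bound _ (avoiding-large-independent (H u) (degree-lower-bound u))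

    impossible : ⊥
    impossible = <⇒≱ large (order≤2k (proj₂ (#-pos (H v₀) (codegree-positive _ 2≤k large (degree-lower-bound v₀)))))
      where
        v₀ : Fin n
        v₀ = fromℕ< {0} (≤-trans (s≤s z≤n) large)
        2≤k : 2 ≤ k
        2≤k = ≤-trans (m≤m+n 2 6) 8≤k

  order≤2k : n ≤ 2 * k
  order≤2k = ≮⇒≥ LargeOrder.impossible

  open Matchings H H-sym H-irrefl

  module Improve (M : Matching) where

    open Matching M renaming (partner to p; partner-invol to p-invol; partner-adj to p-adj)
    open Involution p p-invol

    Improvement : Set
    Improvement = Σ Matching λ M′ → #unmatched M′ < #unmatched M

    improveAlong : ∀ s as t → fixed s ≡ true → s ≢ t → AlternatingPath p s as t → Improvement
    improveAlong s as t free s≢t path =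
      proj₁ augmented , shrink⇒#unmatched< {proj₁ augmented} {M} {s} (proj₂ augmented) (fixed⇒≡ free)
      where augmented = augment M s as t (fixed⇒≡ free) s≢t path

    module NoShortPath
      (many : suc k ≤ #pairs + #fixed)
      {u₁ u₂ : Fin n} (u₁≢u₂ : u₁ ≢ u₂) (free₁ : fixed u₁ ≡ true) (free₂ : fixed u₂ ≡ true)
      (no-free-edge : ∀ {u u′} → fixed u ≡ true → fixed u′ ≡ true → H u u′ ≡ false)
      (no-path₃ : ∀ {a u u′} → fixed u ≡ true → fixed u′ ≡ true → u ≢ u′ →
                  H u a ≡ true → H u′ (p a) ≡ true → ⊥)
      where

      free-nbr-moves : ∀ {u z} → fixed u ≡ true → H u z ≡ true → p z ≢ z
      free-nbr-moves free Huz pz≡z = not-¬ (no-free-edge free (≡⇒fixed pz≡z)) Huz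

      sees-one-end : ∀ {u z} → fixed u ≡ true → H u z ≡ true → H u (p z) ≡ true → ⊥
      sees-one-end free Huz Hupz = triangle-free Huz (p-adj _ (free-nbr-moves free Huz)) Hupz

      sees-pair : Fin n → Fin n → Bool
      sees-pair u e = H u e ∨ H u (p e)

      sees-pair-rep : ∀ {u x} → H u x ≡ true → sees-pair u (rep x) ≡ true
      sees-pair-rep {u} {x} Hux with rep-cases x
      ... | inj₁ rx rewrite rx = ∨-introˡ _ Hux
      ... | inj₂ rx rewrite rx | p-invol x = ∨-introʳ (H u (p x)) Hux

      misses-pair-rep : ∀ {u a} → H u a ≡ false → H u (p a) ≡ false → sees-pair u (rep a) ≡ false
      misses-pair-rep {u} {a} Hua Hupa with rep-cases a
      ... | inj₁ ra rewrite ra | Hua | Hupa = refl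
      ... | inj₂ ra rewrite ra | p-invol a | Hua | Hupa = refl

      -- A free vertex sees only matched vertices, at most one per pair; missing two pairs, its degree
      -- is at most #pairs − 2, which contradicts the degree lower bound while M needs more than k colours.
      misses-two-pairs-impossible : ∀ {u a b} → fixed u ≡ true → p a ≢ a → p b ≢ b → a ≢ b → a ≢ p b →
        H u a ≡ false → H u (p a) ≡ false → H u b ≡ false → H u (p b) ≡ false → ⊥
      misses-two-pairs-impossible {u} {a} {b} free pa≢a pb≢b a≢b a≢pb Hua Hupa Hub Hupb =
        <⇒≱ many (few-colours (# (H u)) order≡ (degree-lower-bound u) (≤-trans (s≤s (s≤s deg≤)) two-missed))
        where
          seen : Fin n → Bool
          seen e = lower e ∧ sees-pair u e
          deg≤ : # (H u) ≤ # seen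
          deg≤ = #-≤-inj (H u) seen rep
            (λ x Hux → cong₂ _∧_ (rep-lower (free-nbr-moves free Hux)) (sees-pair-rep Hux))
            (λ x y Hux Huy rx≡ry →
              [ (λ x≡y → x≡y) , (λ { refl → ⊥-elim (sees-one-end free Huy Hux) }) ]′ (rep-≡ x y rx≡ry))
          unseen : ∀ {c} → H u c ≡ false → H u (p c) ≡ false → seen (rep c) ≡ false
          unseen {c} Huc Hupc = trans (cong (lower (rep c) ∧_) (misses-pair-rep Huc Hupc)) (∧-zeroʳ _)
          two-missed : 2 + # seen ≤ #pairs
          two-missed = #-two-missing seen lower (λ e s → proj₁ (∧-true {lower e} s))
            (λ ra≡rb → [ a≢b , a≢pb ]′ (rep-≡ a b ra≡rb))
            (rep-lower pa≢a) (rep-lower pb≢b) (unseen Hua Hupa) (unseen Hub Hupb)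

      touched : Fin n → Bool
      touched z = anyᵇ (λ u → fixed u ∧ H u z)

      touched-intro : ∀ {u z} → fixed u ≡ true → H u z ≡ true → touched z ≡ true
      touched-intro {u} {z} free Huz = anyᵇ-intro _ u (trans (cong (_∧ H u z) free) Huz)

      untouched⇒unseen : ∀ {u z} → fixed u ≡ true → touched z ≡ false → H u z ≡ false
      untouched⇒unseen {u} {z} free untouched with H u z in Huz
      ... | false = refl
      ... | true = ⊥-elim (not-¬ untouched (touched-intro free Huz))

      record Toucher (z : Fin n) : Set where
        constructor toucher
        field
          {u} : Fin n
          free : fixed u ≡ true
          adj : H u z ≡ true

      touched-elim : ∀ {z} → touched z ≡ true → Toucher z
      touched-elim {z} tz with anyᵇ-elim (λ u → fixed u ∧ H u z) tz
      ... | u , e = toucher (proj₁ (∧-true {fixed u} e)) (proj₂ (∧-true {fixed u} e))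

      touched-moves : ∀ {z} → touched z ≡ true → p z ≢ z
      touched-moves tz with touched-elim tz
      ... | toucher free adj = free-nbr-moves free adj

      touched≢untouched : ∀ {x y} → touched x ≡ true → touched y ≡ false → x ≢ y
      touched≢untouched tx ty refl = true≢false (trans (sym tx) ty)

      pair-touched-once : ∀ {z} → touched z ≡ true → touched (p z) ≡ true → ⊥
      pair-touched-once {z} tz tpz with touched-elim tz | touched-elim tpz
      ... | toucher {u} free adj | toucher {u′} free′ adj′ with u ≟ u′
      ... | yes refl = sees-one-end free adj adj′
      ... | no u≢u′ = no-path₃ free free′ u≢u′ adj adj′

      record FreeNeighbours (a₁ a₂ : Fin n) : Set where
        constructor freeNeighbours
        field
          {u u′} : Fin n
          u≢u′ : u ≢ u′
          free : fixed u ≡ true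
          free′ : fixed u′ ≡ true
          adj : H u a₁ ≡ true
          adj′ : H u′ a₂ ≡ true

      module _ {a₁ a₂} (t₁ : touched a₁ ≡ true) (t₂ : touched a₂ ≡ true)
               (a₁≢a₂ : a₁ ≢ a₂) (a₁≢pa₂ : a₁ ≢ p a₂) where

        -- A second free vertex must see a₁ or a₂: it sees neither partner, and cannot miss both pairs.
        freeNeighbours-via : ∀ {w u} → fixed w ≡ true → H w a₁ ≡ true → H w a₂ ≡ true →
                             fixed u ≡ true → u ≢ w → FreeNeighbours a₁ a₂
        freeNeighbours-via {w} {u} freew Hwa₁ Hwa₂ freeu u≢w with H u a₁ in Hua₁ | H u a₂ in Hua₂
        ... | true | _ = freeNeighbours u≢w freeu freew Hua₁ Hwa₂
        ... | false | true = freeNeighbours (u≢w ∘ sym) freew freeu Hwa₁ Hua₂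
        ... | false | false = ⊥-elim (misses-two-pairs-impossible freeu (touched-moves t₁) (touched-moves t₂)
                                        a₁≢a₂ a₁≢pa₂ Hua₁ (untouched-partner t₁) Hua₂ (untouched-partner t₂))
          where
            untouched-partner : ∀ {a} → touched a ≡ true → H u (p a) ≡ false
            untouched-partner {a} ta with H u (p a) in Hupa
            ... | false = refl
            ... | true = ⊥-elim (pair-touched-once ta (touched-intro freeu Hupa))

        freeNeighbours-of-touched : FreeNeighbours a₁ a₂
        freeNeighbours-of-touched with touched-elim t₁ | touched-elim t₂
        ... | toucher {w₁} free₁′ adj₁ | toucher {w₂} free₂′ adj₂ with w₁ ≟ w₂
        ... | no w₁≢w₂ = freeNeighbours w₁≢w₂ free₁′ free₂′ adj₁ adj₂
        ... | yes refl with u₁ ≟ w₁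
        ... | yes refl = freeNeighbours-via free₁′ adj₁ adj₂ free₂ (u₁≢u₂ ∘ sym)
        ... | no u₁≢w₁ = freeNeighbours-via free₁′ adj₁ adj₂ free₁ u₁≢w₁

      behind : Fin n → Bool
      behind z = not (touched z) ∧ touched (p z)

      behind-elim : ∀ {z} → behind z ≡ true → touched z ≡ false × touched (p z) ≡ true
      behind-elim {z} e with touched z | touched (p z)
      ... | false | true = refl , refl

      behind-intro : ∀ {z} → touched z ≡ false → touched (p z) ≡ true → behind z ≡ true
      behind-intro tz tpz = cong₂ _∧_ (cong not tz) tpz

      sees-behind : Fin n → Bool
      sees-behind e = anyᵇ (λ z → behind z ∧ H e z)

      -- The tie-break between two untouched ends is what makes partner-sees-behind hold.
      chosenEnd : Fin n → Fin n
      chosenEnd e = if touched e then p e else (if touched (p e) then e else (if sees-behind e then p e else e))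

      chosenEnd-cases : ∀ e → chosenEnd e ≡ e ⊎ chosenEnd e ≡ p e
      chosenEnd-cases e with touched e
      ... | true = inj₂ refl
      ... | false with touched (p e)
      ... | true = inj₁ refl
      ... | false with sees-behind e
      ... | true = inj₂ refl
      ... | false = inj₁ refl

      chosenEnd-touched : ∀ {e} → touched e ≡ true → chosenEnd e ≡ p e
      chosenEnd-touched te rewrite te = refl

      chosenEnd-partner-touched : ∀ {e} → touched e ≡ false → touched (p e) ≡ true → chosenEnd e ≡ e
      chosenEnd-partner-touched te tpe rewrite te | tpe = refl

      chosenEnd-both-untouched : ∀ {e} → touched e ≡ false → touched (p e) ≡ false →
                                 chosenEnd e ≡ (if sees-behind e then p e else e)
      chosenEnd-both-untouched te tpe rewrite te | tpe = refl

      chosenEnd-untouched : ∀ e → touched (chosenEnd e) ≡ false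
      chosenEnd-untouched e = by-cases (touched e) (touched (p e)) refl refl
        where
          untouched-end : ∀ {x} → chosenEnd e ≡ x → touched x ≡ false → touched (chosenEnd e) ≡ false
          untouched-end ce tx = subst (λ x → touched x ≡ false) (sym ce) tx
          by-cases : ∀ b₁ b₂ → touched e ≡ b₁ → touched (p e) ≡ b₂ → touched (chosenEnd e) ≡ false
          by-cases true true te tpe = ⊥-elim (pair-touched-once te tpe)
          by-cases true false te tpe = untouched-end (chosenEnd-touched te) tpe
          by-cases false true te tpe = untouched-end (chosenEnd-partner-touched te tpe) te
          by-cases false false te tpe = [ (λ ce → untouched-end ce te) , (λ ce → untouched-end ce tpe) ]′ (chosenEnd-cases e)

      rep-chosenEnd : ∀ {e} → lower e ≡ true → rep (chosenEnd e) ≡ e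
      rep-chosenEnd {e} low with chosenEnd-cases e
      ... | inj₁ ce rewrite ce = lower⇒rep≡ low
      ... | inj₂ ce rewrite ce = trans (rep-p e) (lower⇒rep≡ low)

      chosenEnd-moves : ∀ {e} → lower e ≡ true → p (chosenEnd e) ≢ chosenEnd e
      chosenEnd-moves {e} low with chosenEnd-cases e
      ... | inj₁ ce rewrite ce = lower⇒moves low
      ... | inj₂ ce rewrite ce = p-moves (lower⇒moves low)

      chosen : Fin n → Bool
      chosen z = not (fixed z) ∧ (chosenEnd (rep z) == z)

      chosen-intro : ∀ {z} → p z ≢ z → chosenEnd (rep z) ≡ z → chosen z ≡ true
      chosen-intro pz≢z ce = cong₂ _∧_ (cong not (≢⇒unfixed pz≢z)) (≡⇒== ce)

      record Chosen (z : Fin n) : Set where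
        field
          moves : p z ≢ z
          untouched : touched z ≡ false
          chosenEnd-rep : chosenEnd (rep z) ≡ z

      chosen-elim : ∀ {z} → chosen z ≡ true → Chosen z
      chosen-elim {z} e = from-dec (p z ≟ z)
        where
          chosen≡ : ∀ {b} → fixed z ≡ b → chosen z ≡ (not b ∧ (chosenEnd (rep z) == z))
          chosen≡ = cong (λ b → not b ∧ (chosenEnd (rep z) == z))
          from-dec : Dec (p z ≡ z) → Chosen z
          from-dec (yes pz≡z) = contradiction (trans (sym e) (chosen≡ (≡⇒fixed pz≡z))) true≢false
          from-dec (no pz≢z) = record
            { moves = pz≢z
            ; untouched = subst (λ t → touched t ≡ false) ce (chosenEnd-untouched (rep z))
            ; chosenEnd-rep = ce }
            where ce = ==⇒≡ (trans (sym (chosen≡ (≢⇒unfixed pz≢z))) e)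

      chosen-other-end : ∀ {z₁ z₂} → Chosen z₁ → Chosen z₂ → z₁ ≢ p z₂
      chosen-other-end {z₁} {z₂} c₁ c₂ z₁≡pz₂ = Chosen.moves c₂ (begin
        p z₂                 ≡⟨ z₁≡pz₂ ⟨
        z₁                   ≡⟨ Chosen.chosenEnd-rep c₁ ⟨
        chosenEnd (rep z₁)   ≡⟨ cong (chosenEnd ∘ rep) z₁≡pz₂ ⟩
        chosenEnd (rep (p z₂)) ≡⟨ cong chosenEnd (rep-p z₂) ⟩
        chosenEnd (rep z₂)   ≡⟨ Chosen.chosenEnd-rep c₂ ⟩
        z₂                   ∎)
        where open ≡-Reasoning

      transversal : Fin n → Bool
      transversal z = fixed z ∨ chosen z

      #transversal : #pairs + #fixed ≤ # transversal
      #transversal = begin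
        #pairs + #fixed     ≤⟨ +-monoˡ-≤ #fixed #pairs≤#chosen ⟩
        # chosen + #fixed   ≡⟨ +-comm _ #fixed ⟩
        #fixed + # chosen   ≡⟨ #-disjoint-∨ fixed chosen disjoint ⟨
        # transversal       ∎
        where
          open ≤-Reasoning
          #pairs≤#chosen : #pairs ≤ # chosen
          #pairs≤#chosen = #-≤-inj lower chosen chosenEnd
            (λ e low → chosen-intro (chosenEnd-moves low) (cong chosenEnd (rep-chosenEnd low)))
            (λ e f le lf ce≡cf → trans (sym (rep-chosenEnd le)) (trans (cong rep ce≡cf) (rep-chosenEnd lf)))
          disjoint : ∀ z → (fixed z ∧ chosen z) ≡ false
          disjoint z with fixed z
          ... | true = refl
          ... | false = refl

      H-pp : ∀ {x y} → H x y ≡ true → H (p (p x)) y ≡ true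
      H-pp {x} {y} Hxy = subst (λ t → H t y ≡ true) (sym (p-invol x)) Hxy

      -- u – p z₁ – z₁ – z₂ – p z₂ – u′
      both-partners-touched : ∀ {z₁ z₂} → Chosen z₁ → Chosen z₂ → H z₁ z₂ ≡ true →
                              touched (p z₁) ≡ true → touched (p z₂) ≡ true → Improvement
      both-partners-touched {z₁} {z₂} c₁ c₂ H₁₂ tp₁ tp₂
        with freeNeighbours-of-touched tp₁ tp₂ (H⇒≢ H₁₂ ∘ p-injective)
                                       (λ e → touched≢untouched tp₁ (Chosen.untouched c₂) (trans e (p-invol z₂)))
      ... | freeNeighbours {u} {u′} u≢u′ free free′ adj adj′ =
        improveAlong u (p z₁ ∷ z₂ ∷ []) u′ free u≢u′
          (p-moves (Chosen.moves c₁) , adj ,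
           (touched≢untouched tp₁ (Chosen.untouched c₂) ∘ sym ,
            H⇒≢ H₁₂ ∘ sym ∘ (λ e → trans e (p-invol z₁))) All.∷ All.[] ,
           (Chosen.moves c₂ , H-pp H₁₂ , All.[] , fixed⇒≡ free′ , H-sym adj′))

      no-partner-touched : ∀ {z₁ z₂} → Chosen z₁ → Chosen z₂ → H z₁ z₂ ≡ true →
                           touched (p z₁) ≡ false → touched (p z₂) ≡ false → ⊥
      no-partner-touched c₁ c₂ H₁₂ tp₁ tp₂ =
        misses-two-pairs-impossible free₁ (Chosen.moves c₁) (Chosen.moves c₂) (H⇒≢ H₁₂) (chosen-other-end c₁ c₂)
          (untouched⇒unseen free₁ (Chosen.untouched c₁)) (untouched⇒unseen free₁ tp₁)
          (untouched⇒unseen free₁ (Chosen.untouched c₂)) (untouched⇒unseen free₁ tp₂)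

      partner-sees-behind : ∀ {z y} → Chosen z → touched (p z) ≡ false → H z y ≡ true → behind y ≡ true →
                            ∃ λ z₃ → behind z₃ ≡ true × H (p z) z₃ ≡ true
      partner-sees-behind {z} {y} c tpz Hzy behind-y = by-sees-behind (sees-behind e) refl
        where
          e = rep z
          tz = Chosen.untouched c
          te : touched e ≡ false
          te = [ (λ r → subst (λ t → touched t ≡ false) (sym r) tz) ,
                 (λ r → subst (λ t → touched t ≡ false) (sym r) tpz) ]′ (rep-cases z)
          tpe : touched (p e) ≡ false
          tpe = [ (λ r → subst (λ t → touched (p t) ≡ false) (sym r) tpz) ,
                  (λ r → subst (λ t → touched t ≡ false) (sym (trans (cong p r) (p-invol z))) tz) ]′ (rep-cases z)
          chosenEnd≡ : ∀ {b} → sees-behind e ≡ b → (if b then p e else e) ≡ z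
          chosenEnd≡ sb = trans (sym (cong (λ b → if b then p e else e) sb))
                                (trans (sym (chosenEnd-both-untouched te tpe)) (Chosen.chosenEnd-rep c))
          by-sees-behind : ∀ b → sees-behind e ≡ b → ∃ λ z₃ → behind z₃ ≡ true × H (p z) z₃ ≡ true
          by-sees-behind false sb = contradiction (trans (sym (anyᵇ-intro (λ x → behind x ∧ H e x) y
            (cong₂ _∧_ behind-y (subst (λ t → H t y ≡ true) (sym (chosenEnd≡ sb)) Hzy)))) sb) true≢false
          by-sees-behind true sb with anyᵇ-elim (λ x → behind x ∧ H e x) sb
          ... | z₃ , behind∧H with ∧-true {behind z₃} behind∧H
          ... | behind₃ , He₃ = z₃ , behind₃ , subst (λ t → H t z₃ ≡ true) (trans (sym (p-invol e)) (cong p (chosenEnd≡ sb))) He₃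

      -- u – p z₃ – z₃ – p zB – zB – zA – p zA – u′
      long-path : ∀ {zA zB z₃} → Chosen zA → Chosen zB → H zA zB ≡ true →
                  touched (p zA) ≡ true → touched (p zB) ≡ false → behind z₃ ≡ true → H (p zB) z₃ ≡ true →
                  Improvement
      long-path {zA} {zB} {z₃} cA cB HAB tpA tpB behind₃ H₃ with behind-elim behind₃ | z₃ ≟ zA
      ... | _ | yes refl = ⊥-elim (triangle-free (H-sym (p-adj zB (Chosen.moves cB))) (H-sym HAB) H₃)
      ... | t₃ , tp₃ | no z₃≢zA
        with freeNeighbours-of-touched tp₃ tpA (z₃≢zA ∘ p-injective) (λ q → touched≢untouched tp₃ tA (trans q (p-invol zA)))
        where tA = Chosen.untouched cA
      ... | freeNeighbours {u} {u′} u≢u′ free free′ adj adj′ =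
        improveAlong u (p z₃ ∷ p zB ∷ zA ∷ []) u′ free u≢u′
          (touched-moves tp₃ , adj ,
           (touched≢untouched tp₃ tpB ∘ sym ,
            touched≢untouched tp₃ tB ∘ sym ∘ (λ q → trans (sym (p-invol zB)) (cong p (trans q (p-invol z₃))))) All.∷
           (touched≢untouched tp₃ tA ∘ sym , z₃≢zA ∘ sym ∘ (λ q → trans q (p-invol z₃))) All.∷ All.[] ,
           (p-moves (Chosen.moves cB) , H-pp (H-sym H₃) ,
            (touched≢untouched tpA tB ∘ (λ q → trans (cong p q) (p-invol zB)) ,
             H⇒≢ HAB ∘ (λ q → trans q (p-invol zB))) All.∷ All.[] ,
            (Chosen.moves cA , H-pp (H-sym HAB) , All.[] , fixed⇒≡ free′ , H-sym adj′)))
        where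
          tA = Chosen.untouched cA
          tB = Chosen.untouched cB

      one-partner-touched : ∀ {zA zB} → Chosen zA → Chosen zB → H zA zB ≡ true →
                            touched (p zA) ≡ true → touched (p zB) ≡ false → Improvement
      one-partner-touched cA cB HAB tpA tpB
        with partner-sees-behind cB tpB (H-sym HAB) (behind-intro (Chosen.untouched cA) tpA)
      ... | z₃ , behind₃ , H₃ = long-path cA cB HAB tpA tpB behind₃ H₃

      transversal-edge : ∀ {z₁ z₂} → transversal z₁ ≡ true → transversal z₂ ≡ true → H z₁ z₂ ≡ true →
                         Improvement
      transversal-edge {z₁} {z₂} s₁ s₂ H₁₂ with ∨-elim {fixed z₁} s₁ | ∨-elim {fixed z₂} s₂
      ... | inj₁ f₁ | inj₁ f₂ = ⊥-elim (not-¬ (no-free-edge f₁ f₂) H₁₂)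
      ... | inj₁ f₁ | inj₂ c₂ = ⊥-elim (not-¬ (untouched⇒unseen f₁ (Chosen.untouched (chosen-elim c₂))) H₁₂)
      ... | inj₂ c₁ | inj₁ f₂ = ⊥-elim (not-¬ (untouched⇒unseen f₂ (Chosen.untouched (chosen-elim c₁))) (H-sym H₁₂))
      ... | inj₂ c₁ | inj₂ c₂ = by-partners (touched (p z₁)) (touched (p z₂)) refl refl
        where
          by-partners : ∀ b₁ b₂ → touched (p z₁) ≡ b₁ → touched (p z₂) ≡ b₂ → Improvement
          by-partners true true tp₁ tp₂ = both-partners-touched (chosen-elim c₁) (chosen-elim c₂) H₁₂ tp₁ tp₂
          by-partners true false tp₁ tp₂ = one-partner-touched (chosen-elim c₁) (chosen-elim c₂) H₁₂ tp₁ tp₂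
          by-partners false true tp₁ tp₂ = one-partner-touched (chosen-elim c₂) (chosen-elim c₁) (H-sym H₁₂) tp₂ tp₁
          by-partners false false tp₁ tp₂ = ⊥-elim (no-partner-touched (chosen-elim c₁) (chosen-elim c₂) H₁₂ tp₁ tp₂)

      -- The transversal has #pairs + #fixed > k vertices, so it is not independent.
      improvement : Improvement
      improvement with any? (λ z₁ → any? (λ z₂ →
                         transversal z₁ Bool.≟ true ×-dec (transversal z₂ Bool.≟ true ×-dec H z₁ z₂ Bool.≟ true)))
      ... | yes (z₁ , z₂ , s₁ , s₂ , H₁₂) = transversal-edge s₁ s₂ H₁₂
      ... | no no-edge = ⊥-elim (<⇒≱ many (≤-trans #transversal
              (independence-bound transversal (λ x y sx sy Hxy → no-edge (x , y , sx , sy , Hxy)))))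

    no-free-edge-of : ¬ (∃ λ u → ∃ λ u′ → fixed u ≡ true × fixed u′ ≡ true × H u u′ ≡ true) →
                      ∀ {u u′} → fixed u ≡ true → fixed u′ ≡ true → H u u′ ≡ false
    no-free-edge-of none {u} {u′} free free′ = ¬-not (λ Huu′ → none (u , u′ , free , free′ , Huu′))

    improve : suc k ≤ # isRep → Improvement
    improve many-reps
      with any? (λ u → any? (λ u′ → fixed u Bool.≟ true ×-dec (fixed u′ Bool.≟ true ×-dec H u u′ Bool.≟ true)))
    ... | yes (u , u′ , free , free′ , Huu′) = improveAlong u [] u′ free (H⇒≢ Huu′) (fixed⇒≡ free′ , Huu′)
    ... | no no-path₁ = without-path₁ (no-free-edge-of no-path₁)
      where
        many = subst (suc k ≤_) #isRep many-reps
        without-path₁ : (∀ {u u′} → fixed u ≡ true → fixed u′ ≡ true → H u u′ ≡ false) → Improvement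
        without-path₁ no-free-edge
          with #≥2 fixed (two-unmatched order≡ many order≤2k)
             | any? (λ a → any? (λ u → any? (λ u′ →
                 fixed u Bool.≟ true ×-dec (fixed u′ Bool.≟ true ×-dec (¬? (u ≟ u′) ×-dec
                 (H u a Bool.≟ true ×-dec H u′ (p a) Bool.≟ true))))))
        ... | _ | yes (a , u , u′ , free , free′ , u≢u′ , Hua , Hu′pa) =
          improveAlong u (a ∷ []) u′ free u≢u′
            ((λ pa≡a → not-¬ (no-free-edge free (≡⇒fixed pa≡a)) Hua) , Hua , All.[] , fixed⇒≡ free′ , H-sym Hu′pa)
        ... | u₁ , u₂ , u₁≢u₂ , free₁ , free₂ | no no-path₃ =
          NoShortPath.improvement many u₁≢u₂ free₁ free₂ no-free-edge
            (λ {a} {u} {u′} f f′ u≢u′ Hua Hu′pa → no-path₃ (a , u , u′ , f , f′ , u≢u′ , Hua , Hu′pa))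

  #orbits : Matching → ℕ
  #orbits M = # (Involution.isRep (Matching.partner M) (Matching.partner-invol M))

  improve-until-few-orbits : ∀ b (M : Matching) → #unmatched M ≤ b → Σ Matching λ M′ → #orbits M′ ≤ k
  improve-until-few-orbits b M bound with #orbits M ≤? k
  ... | yes few = M , few
  ... | no many with Improve.improve M (≰⇒> many) | b
  ... | M′ , fewer | zero = ⊥-elim (<⇒≱ fewer (≤-trans bound z≤n))
  ... | M′ , fewer | suc b′ = improve-until-few-orbits b′ M′ (≤-pred (<-≤-trans fewer bound))

  matching-with-few-orbits : Σ Matching λ M → #orbits M ≤ k
  matching-with-few-orbits = improve-until-few-orbits n noMatching (#≤n _)

module ThreeK₁Free (G : Graph) (3K₁-free : ThreeK1Free G) where

  open Graph G renaming (sym to adj-sym)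

  coadj : Fin n → Fin n → Bool
  coadj x y = not (adj x y) ∧ not (x == y)

  coadj⇒nonadj : ∀ {x y} → coadj x y ≡ true → adj x y ≡ false
  coadj⇒nonadj {x} {y} e with adj x y
  ... | false = refl

  coadj-intro : ∀ {x y} → adj x y ≡ false → x ≢ y → coadj x y ≡ true
  coadj-intro nonadj x≢y = cong₂ _∧_ (cong not nonadj) (cong not (==-false x≢y))

  coadj-irrefl : ∀ x → coadj x x ≡ false
  coadj-irrefl x = trans (cong (λ b → not (adj x x) ∧ not b) (≡⇒== {x = x} refl)) (∧-zeroʳ _)

  coadj⇒≢ : ∀ {x y} → coadj x y ≡ true → x ≢ y
  coadj⇒≢ {x} e refl = true≢false (trans (sym e) (coadj-irrefl x))

  coadj-sym : ∀ {x y} → coadj x y ≡ true → coadj y x ≡ true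
  coadj-sym {x} {y} e = coadj-intro (trans (adj-sym y x) (coadj⇒nonadj e)) (coadj⇒≢ e ∘ sym)

  coadj-triangle-free : ∀ {x y z} → coadj x y ≡ true → coadj y z ≡ true → coadj x z ≡ true → ⊥
  coadj-triangle-free {x} {y} {z} xy yz xz
    with 3K₁-free x y z (coadj⇒≢ xy) (coadj⇒≢ yz) (coadj⇒≢ xz)
  ... | inj₁ adj-xy = true≢false (trans (sym adj-xy) (coadj⇒nonadj xy))
  ... | inj₂ (inj₁ adj-yz) = true≢false (trans (sym adj-yz) (coadj⇒nonadj yz))
  ... | inj₂ (inj₂ adj-xz) = true≢false (trans (sym adj-xz) (coadj⇒nonadj xz))

  coadj-degree : ∀ {d} v → degree G v ≤ d → n ≤ # (coadj v) + suc d
  coadj-degree {d} v deg≤d = begin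
    n                                         ≡⟨ #-not (adj v) ⟨
    # (adj v) + # (λ x → not (adj v x))       ≤⟨ +-mono-≤ (≤-trans (≤-reflexive (sym degree≡#adj)) deg≤d) nonadj≤ ⟩
    d + (# (coadj v) + 1)                     ≡⟨ trans (+-comm d _) (+-assoc _ 1 d) ⟩
    # (coadj v) + suc d                       ∎
    where
      open ≤-Reasoning
      degree≡#adj : degree G v ≡ # (adj v)
      degree≡#adj = Counting.length-filterᵇ (adj v) (allFin n)
      nonadj≤ : # (λ x → not (adj v x)) ≤ # (coadj v) + 1
      nonadj≤ = ≤-trans (#-∨-≤ _ (coadj v) (_== v) split) (+-monoʳ-≤ _ (#-singleton v))
        where
          split : ∀ x → not (adj v x) ≡ true → (coadj v x ∨ (x == v)) ≡ true
          split x nonadj with x ≟ v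
          ... | yes x≡v = ∨-zeroʳ (coadj v x)
          ... | no x≢v = ∨-introˡ _ (coadj-intro (not-true nonadj) (x≢v ∘ sym))

  independent≤ω : ∀ {ω} → (∀ vs → IsClique G vs → length vs ≤ ω) → ∀ S → Independent coadj S → # S ≤ ω
  independent≤ω cliques≤ω S independent = begin
    # S                              ≡⟨ Counting.length-filterᵇ S (allFin n) ⟨
    length (filterᵇ S (allFin n))    ≤⟨ cliques≤ω _ (filter⁺ (T? ∘ S) (allFin⁺ n) , clique) ⟩
    _                                ∎
    where
      open ≤-Reasoning
      member : ∀ {x} → x ∈ filterᵇ S (allFin n) → S x ≡ true
      member {x} x∈ with S x | proj₂ (∈-filter⁻ (T? ∘ S) {xs = allFin n} x∈)
      ... | true | _ = refl
      clique : ∀ u v → u ∈ filterᵇ S (allFin n) → v ∈ filterᵇ S (allFin n) → u ≢ v → Adj G u v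
      clique u v u∈ v∈ u≢v with adj u v in adj-uv
      ... | true = refl
      ... | false = ⊥-elim (independent u v (member u∈) (member v∈) (coadj-intro adj-uv u≢v))

  open Matchings coadj coadj-sym coadj-irrefl

  matchingColouring : ∀ {k} (M : Matching) → # (Involution.isRep (Matching.partner M) (Matching.partner-invol M)) ≤ k →
                      Colourable G k
  matchingColouring M few = proj₁ colouring , proper
    where
      open Matching M
      colouring = Involution.orbitColouring partner partner-invol few
      proper : ProperColouring G _ (proj₁ colouring)
      proper u v adj-uv cu≡cv with proj₂ colouring u v cu≡cv | partner v ≟ v
      ... | inj₁ refl | _ = true≢false (trans (sym adj-uv) (irrefl u))
      ... | inj₂ refl | yes pv≡v = true≢false (trans (sym adj-uv) (trans (cong (λ t → adj t v) pv≡v) (irrefl v)))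
      ... | inj₂ refl | no pv≢v = true≢false (trans (sym adj-uv) (trans (adj-sym _ v) (coadj⇒nonadj (partner-adj v pv≢v))))

mainTheorem3 : (G : Graph) → ThreeK1Free G →
    (Δ ω : ℕ) → IsMaxDegree G Δ → IsCliqueNumber G ω →
    9 ≤ Δ → Colourable G (ω ⊔ (Δ ∸ 1))
mainTheorem3 G 3K₁-free Δ ω (degree≤Δ , _) (_ , cliques≤ω) 9≤Δ =
  uncurry matchingColouring matching-with-few-orbits
  where
    open ThreeK₁Free G 3K₁-free
    k = ω ⊔ (Δ ∸ 1)
    Δ≤1+k : Δ ≤ suc k
    Δ≤1+k = ≤-trans (m≤n+m∸n Δ 1) (s≤s (m≤n⊔m ω (Δ ∸ 1)))
    8≤k : 8 ≤ k
    8≤k = ≤-trans (∸-monoˡ-≤ 1 9≤Δ) (m≤n⊔m ω (Δ ∸ 1))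
    open TriangleFree coadj coadj-sym coadj-irrefl coadj-triangle-free k 8≤k
      (λ v → coadj-degree v (≤-trans (degree≤Δ v) Δ≤1+k))
      (λ S independent → ≤-trans (independent≤ω cliques≤ω S independent) (m≤m⊔n ω (Δ ∸ 1)))
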